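{- Let $\tau \subseteq \{0,1,-,+,\cdot,1',\smile,;\}$ be a relation algebra reduct signature with $\{ -,;\} \subseteq \tau$. Then the class of representable $\tau$-structures does not have the finite representation property.
   Context: For binary relations $R,S \subseteq X\times X$, relational composition is $R;S=\{(x,z)\mid \exists y: (x,y)\in R,(y,z)\in S\}$, converse is $\breve R=\{(y,x)\mid (x,y)\in R\}$, and identity is $1'=\{(x,x)\mid x\in X\}$. For a signature $\tau \subseteq \{0,1,-,+,\cdot,1',\smile,;\}$, a proper $\tau$-structure is a set of binary relations over some base set $X$, closed under the operations of $\tau$, where $0,1,-,+,\cdot$ are interpreted as the empty relation, $X\times X$, complement relative to $X\times X$, union and intersection, and $1',\smile,;$ as relational identity, converse and composition. A $\tau$-structure is representable if it is isomorphic to a proper $\tau$-structure; such an isomorphism is a representation, and it is finite if the base $X$ is finite. The class of representable $\tau$-structures has the finite representation property (FRP) if every finite representable $\tau$-structure has a finite representation. -}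

module Defs where

open import Data.Bool using (Bool; T)
open import Data.Nat using (ℕ)
open import Data.Fin using (Fin)
open import Data.Empty using (⊥)
open import Data.Unit using (⊤)
open import Data.Sum using (_⊎_)
open import Data.Product using (Σ; ∃; _×_)
open import Relation.Nullary using (¬_)
open import Relation.Binary.PropositionalEquality using (_≡_)
open import Function.Bundles using (_↔_)

data Sym : Set where
  𝟘 𝟙 minus plus meet ident conv comp : Sym

Signature : Set
Signature = Sym → Bool

Op : Sym → Set → Set
Op 𝟘     A = A
Op 𝟙     A = A
Op minus A = A → A
Op plus  A = A → A → A
Op meet  A = A → A → A
Op ident A = A
Op conv  A = A → A
Op comp  A = A → A → A

record Structure (τ : Signature) : Set₁ where
  field
    Carrier : Set
    op      : (s : Sym) → T (τ s) → Op s Carrier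
open Structure public

Finite : {τ : Signature} → Structure τ → Set
Finite A = Σ ℕ λ k → Carrier A ↔ Fin k

BRel : Set → Set₁
BRel X = X → X → Set

infix 4 _≐_
_≐_ : {X : Set} → BRel X → BRel X → Set
R ≐ S = (∀ x y → R x y → S x y) × (∀ x y → S x y → R x y)

∅ᴿ : {X : Set} → BRel X
∅ᴿ _ _ = ⊥

Univᴿ : {X : Set} → BRel X
Univᴿ _ _ = ⊤

∁ᴿ : {X : Set} → BRel X → BRel X
∁ᴿ R x y = ¬ R x y

_∪ᴿ_ : {X : Set} → BRel X → BRel X → BRel X
(R ∪ᴿ S) x y = R x y ⊎ S x y

_∩ᴿ_ : {X : Set} → BRel X → BRel X → BRel X
(R ∩ᴿ S) x y = R x y × S x y

Idᴿ : {X : Set} → BRel X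
Idᴿ x y = x ≡ y

Convᴿ : {X : Set} → BRel X → BRel X
Convᴿ R x y = R y x

_⨾ᴿ_ : {X : Set} → BRel X → BRel X → BRel X
(R ⨾ᴿ S) x z = ∃ λ y → R x y × S y z

Hom : {C X : Set} (s : Sym) → (C → BRel X) → Op s C → Set
Hom 𝟘     h c = h c ≐ ∅ᴿ
Hom 𝟙     h c = h c ≐ Univᴿ
Hom minus h f = ∀ a → h (f a) ≐ ∁ᴿ (h a)
Hom plus  h f = ∀ a b → h (f a b) ≐ (h a ∪ᴿ h b)
Hom meet  h f = ∀ a b → h (f a b) ≐ (h a ∩ᴿ h b)
Hom ident h c = h c ≐ Idᴿ
Hom conv  h f = ∀ a → h (f a) ≐ Convᴿ (h a)
Hom comp  h f = ∀ a b → h (f a b) ≐ (h a ⨾ᴿ h b)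

-- A representation of A over base X: an injective τ-homomorphism into
-- the binary relations on X; equivalently an isomorphism of A onto the
-- proper τ-structure given by its image.
record Representation {τ : Signature} (A : Structure τ) (X : Set) : Set₁ where
  field
    h   : Carrier A → BRel X
    inj : ∀ a b → h a ≐ h b → a ≡ b
    hom : (s : Sym) (p : T (τ s)) → Hom s h (op A s p)

Representable : {τ : Signature} → Structure τ → Set₁
Representable A = Σ Set λ X → Representation A X

FinitelyRepresentable : {τ : Signature} → Structure τ → Set₁
FinitelyRepresentable A = Σ ℕ λ n → Representation A (Fin n)

FRP : Signature → Set₁
FRP τ = (A : Structure τ) → Finite A → Representable A → FinitelyRepresentable A

module Submission where

-- The point algebra (the eight unions of <, = and > on a linear order) is represented over
-- (ℚ, <), by density and the absence of endpoints. In any representation with - and ;, the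
-- zero of ; is forced to be the empty relation, so r = {<} satisfies r ; -r = 1: every point
-- has a strict r-successor, and r ; r = r makes r transitive. Iterating successors produces a
-- strictly increasing sequence, which cannot live in a finite base.

open import Defs
open import Algebra.Definitions using (Zero)
open import Data.Bool using (Bool; true; false; T; not; _∧_; _∨_)
open import Data.Bool.Properties using (T-∧; T-∨; ∧-zeroʳ)
open import Data.Empty using (⊥-elim)
open import Data.Fin using (Fin; toℕ)
open import Data.Fin.Properties using (pigeonhole; 2↔Bool; *↔×)
open import Data.Nat using (ℕ; zero; suc; s≤s)
open import Data.Nat.Properties using (n<1+n; m≤n⇒m<n∨m≡n)
import Data.Nat as ℕ
open import Data.Product using (∃; ∃₂; _×_; _,_; proj₁; proj₂)
open import Data.Product.Function.NonDependent.Propositional using (_×-↔_)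
open import Data.Rational using (ℚ; 1ℚ; _+_; -_)
open import Data.Rational.Properties
  using (<-isStrictTotalOrder; <-dense; +-identityʳ; +-monoʳ-<; positive⁻¹; negative⁻¹)
import Data.Rational as ℚ
open import Data.Sum using (inj₁; inj₂)
open import Function using (_∘_)
open import Function.Bundles using (_↔_; _⇔_; mk⇔; Equivalence)
open import Function.Properties.Inverse using (↔-sym; ↔-trans)
open import Relation.Binary.Definitions
  using (DecidableEquality; Transitive; Irreflexive; Dense; tri<; tri≈; tri>)
open import Relation.Binary.Structures using (IsStrictTotalOrder)
open import Relation.Binary.PropositionalEquality
  using (_≡_; _≢_; refl; sym; cong₂; subst)
open import Relation.Nullary using (¬_; yes; no)
open import Relation.Nullary.Decidable using (⌊_⌋; toWitness; fromWitness)

open Equivalence using (to; from)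

T-not : ∀ {b} → T (not b) ⇔ (¬ T b)
T-not {false} = mk⇔ (λ _ ()) _
T-not {true}  = mk⇔ (λ ()) (λ ¬t → ¬t _)

T-injective : ∀ {a b} → (T a → T b) → (T b → T a) → a ≡ b
T-injective {false} {false} _   _   = refl
T-injective {false} {true}  _   b⇒a = ⊥-elim (b⇒a _)
T-injective {true}  {false} a⇒b _   = ⊥-elim (a⇒b _)
T-injective {true}  {true}  _   _   = refl

serial-strict-order⇒empty : ∀ {n} {_≺_ : BRel (Fin n)} →
  Transitive _≺_ → Irreflexive _≡_ _≺_ → (∀ x → ∃ (x ≺_)) → ¬ Fin n
serial-strict-order⇒empty {n} {_≺_} ≺-trans ≺-irrefl serial x₀ =
  let i , j , i<j , chainᵢ≡chainⱼ = pigeonhole (n<1+n n) (chain ∘ toℕ)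
  in ≺-irrefl chainᵢ≡chainⱼ (chain-increasing i<j)
  where
  chain : ℕ → Fin n
  chain zero    = x₀
  chain (suc i) = proj₁ (serial (chain i))

  chain-increasing : ∀ {i j} → i ℕ.< j → chain i ≺ chain j
  chain-increasing {i} {suc j} (s≤s i≤j) with m≤n⇒m<n∨m≡n i≤j
  ... | inj₁ i<j  = ≺-trans (chain-increasing i<j) (proj₂ (serial (chain j)))
  ... | inj₂ refl = proj₂ (serial (chain i))

module _ {τ : Signature} (A : Structure τ) (minus∈τ : T (τ minus)) (comp∈τ : T (τ comp)) where
  infix 8 ∁_
  infixl 7 _⨾_
  private
    ∁_ : Carrier A → Carrier A
    ∁_ = op A minus minus∈τ

    _⨾_ : Carrier A → Carrier A → Carrier A
    _⨾_ = op A comp comp∈τ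

  module _ {X : Set} (ρ : Representation A X) where
    open Representation ρ

    private
      h-∁ : ∀ a {x y} → h (∁ a) x y → ¬ h a x y
      h-∁ a = proj₁ (hom minus minus∈τ a) _ _

      ∁-h : ∀ a {x y} → ¬ h a x y → h (∁ a) x y
      ∁-h a = proj₂ (hom minus minus∈τ a) _ _

      split : ∀ a b {x y} → h (a ⨾ b) x y → ∃ λ w → h a x w × h b w y
      split a b = proj₁ (hom comp comp∈τ a b) _ _

      join : ∀ a b {x w y} → h a x w → h b w y → h (a ⨾ b) x y
      join a b p q = proj₂ (hom comp comp∈τ a b) _ _ (_ , p , q)

    zero⇒empty : ∀ {z} → Zero _≡_ z _⨾_ → ∀ {x y} → ¬ h z x y
    zero⇒empty {z} (zˡ , zʳ) {x} {y} zxy =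
      let w , zxw , ∁zwy = split z (∁ z) (subst (λ a → h a x y) (sym (zˡ (∁ z))) zxy)
          ¬zwy = h-∁ z ∁zwy
          ¬zwx : ¬ h z w x
          ¬zwx zwx = ¬zwy (subst (λ a → h a w y) (zˡ z) (join z z zwx zxy))
      in ¬zwy (subst (λ a → h a w y) (zʳ (∁ z)) (join (∁ z) z (∁-h z ¬zwx) zxy))

    idempotent⇒transitive : ∀ {r} → r ⨾ r ≡ r → Transitive (h r)
    idempotent⇒transitive {r} r⨾r≡r {x} {_} {z} p q =
      subst (λ a → h a x z) r⨾r≡r (join r r p q)

    strict-successor : ∀ {z r} → Zero _≡_ z _⨾_ → r ⨾ ∁ r ≡ ∁ z →
      ∀ x → ∃ λ y → h r x y × ¬ h r y x
    strict-successor {z} {r} z-zero r⨾∁r≡∁z x =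
      let ∁zxx = ∁-h z (zero⇒empty z-zero)
          y , rxy , ∁ryx = split r (∁ r) (subst (λ a → h a x x) (sym r⨾∁r≡∁z) ∁zxx)
      in y , rxy , h-∁ r ∁ryx

    empty-base⇒trivial : ¬ X → ∀ a b → a ≡ b
    empty-base⇒trivial ¬X a b = inj a b ((λ x → ⊥-elim (¬X x)) , (λ x → ⊥-elim (¬X x)))

  no-finite-representation : ∀ {z r} → Zero _≡_ z _⨾_ → z ≢ ∁ z →
    r ⨾ r ≡ r → r ⨾ ∁ r ≡ ∁ z → ¬ FinitelyRepresentable A
  no-finite-representation {z} {r} z-zero z≢∁z r⨾r≡r r⨾∁r≡∁z (n , ρ) =
    z≢∁z (empty-base⇒trivial ρ (serial-strict-order⇒empty ≺-trans ≺-irrefl ≺-serial) z (∁ z))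
    where
    open Representation ρ

    _≺_ : BRel (Fin n)
    x ≺ y = h r x y × ¬ h r y x

    r-trans : Transitive (h r)
    r-trans = idempotent⇒transitive ρ r⨾r≡r

    ≺-trans : Transitive _≺_
    ≺-trans (p , ¬p) (q , ¬q) = r-trans p q , λ zx → ¬q (r-trans zx p)

    ≺-irrefl : Irreflexive _≡_ _≺_
    ≺-irrefl refl (p , ¬p) = ¬p p

    ≺-serial : ∀ x → ∃ (x ≺_)
    ≺-serial = strict-successor ρ z-zero r⨾∁r≡∁z

data Atom : Set where
  lt eq gt : Atom

_≟ᴬ_ : DecidableEquality Atom
lt ≟ᴬ lt = yes refl
eq ≟ᴬ eq = yes refl
gt ≟ᴬ gt = yes refl
lt ≟ᴬ eq = no λ ()
lt ≟ᴬ gt = no λ ()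
eq ≟ᴬ lt = no λ ()
eq ≟ᴬ gt = no λ ()
gt ≟ᴬ lt = no λ ()
gt ≟ᴬ eq = no λ ()

T-≟ᴬ : ∀ {k k'} → T ⌊ k ≟ᴬ k' ⌋ ⇔ k ≡ k'
T-≟ᴬ {k} {k'} = mk⇔ (toWitness {a? = k ≟ᴬ k'}) fromWitness

converse : Atom → Atom
converse lt = gt
converse eq = eq
converse gt = lt

anyAtom : (Atom → Bool) → Bool
anyAtom f = f lt ∨ f eq ∨ f gt

T-anyAtom : ∀ f → T (anyAtom f) ⇔ ∃ (T ∘ f)
T-anyAtom f = mk⇔ to′ from′
  where
  to′ : T (anyAtom f) → ∃ (T ∘ f)
  to′ t with to (T-∨ {f lt}) t
  ... | inj₁ t′ = lt , t′
  ... | inj₂ t′ with to (T-∨ {f eq}) t′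
  ...   | inj₁ t″ = eq , t″
  ...   | inj₂ t″ = gt , t″

  from′ : ∃ (T ∘ f) → T (anyAtom f)
  from′ (lt , t) = from (T-∨ {f lt}) (inj₁ t)
  from′ (eq , t) = from (T-∨ {f lt}) (inj₂ (from (T-∨ {f eq}) (inj₁ t)))
  from′ (gt , t) = from (T-∨ {f lt}) (inj₂ (from (T-∨ {f eq}) (inj₂ t)))

-- k ∈ᴬ p ⨾ q says that the order relation k is contained in the composite p ; q
-- in every dense linear order without endpoints.
infix 7 _∈ᴬ_⨾_
_∈ᴬ_⨾_ : Atom → Atom → Atom → Bool
k ∈ᴬ eq ⨾ q  = ⌊ q ≟ᴬ k ⌋
k ∈ᴬ p  ⨾ eq = ⌊ p ≟ᴬ k ⌋
k ∈ᴬ lt ⨾ lt = ⌊ lt ≟ᴬ k ⌋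
k ∈ᴬ gt ⨾ gt = ⌊ gt ≟ᴬ k ⌋
_ ∈ᴬ lt ⨾ gt = true
_ ∈ᴬ gt ⨾ lt = true

-- An element of the point algebra is a set of atoms, listed as membership of lt, eq, gt.
PointRel : Set
PointRel = Bool × Bool × Bool

infix 7 _∋ᴾ_
_∋ᴾ_ : PointRel → Atom → Bool
(a , _ , _) ∋ᴾ lt = a
(_ , b , _) ∋ᴾ eq = b
(_ , _ , c) ∋ᴾ gt = c

tabulate : (Atom → Bool) → PointRel
tabulate f = f lt , f eq , f gt

tabulate-∋ᴾ : ∀ f k → tabulate f ∋ᴾ k ≡ f k
tabulate-∋ᴾ f lt = refl
tabulate-∋ᴾ f eq = refl
tabulate-∋ᴾ f gt = refl

∋ᴾ-injective : ∀ {e f} → (∀ k → e ∋ᴾ k ≡ f ∋ᴾ k) → e ≡ f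
∋ᴾ-injective same = cong₂ _,_ (same lt) (cong₂ _,_ (same eq) (same gt))

atomic : Atom → PointRel
atomic k = tabulate λ k' → ⌊ k' ≟ᴬ k ⌋

∅ᴾ : PointRel
∅ᴾ = tabulate λ _ → false

composite : PointRel → PointRel → Atom → Bool
composite e f k = anyAtom λ p → anyAtom λ q → e ∋ᴾ p ∧ f ∋ᴾ q ∧ k ∈ᴬ p ⨾ q

T-composite : ∀ {e f k} →
  T (composite e f k) ⇔ ∃₂ λ p q → T (e ∋ᴾ p) × T (f ∋ᴾ q) × T (k ∈ᴬ p ⨾ q)
T-composite {e} {f} {k} = mk⇔ to′ from′
  where
  witness : Atom → Atom → Bool
  witness p q = e ∋ᴾ p ∧ f ∋ᴾ q ∧ k ∈ᴬ p ⨾ q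

  to′ : T (composite e f k) → ∃₂ λ p q → T (e ∋ᴾ p) × T (f ∋ᴾ q) × T (k ∈ᴬ p ⨾ q)
  to′ t =
    let p , t′ = to (T-anyAtom (anyAtom ∘ witness)) t
        q , t″ = to (T-anyAtom (witness p)) t′
        ep , t‴ = to (T-∧ {e ∋ᴾ p}) t″
    in p , q , ep , to (T-∧ {f ∋ᴾ q}) t‴

  from′ : (∃₂ λ p q → T (e ∋ᴾ p) × T (f ∋ᴾ q) × T (k ∈ᴬ p ⨾ q)) → T (composite e f k)
  from′ (p , q , ep , fq , kpq) =
    from (T-anyAtom (anyAtom ∘ witness)) (p , from (T-anyAtom (witness p))
      (q , from (T-∧ {e ∋ᴾ p}) (ep , from (T-∧ {f ∋ᴾ q}) (fq , kpq))))

_⨾ᴾ_ : PointRel → PointRel → PointRel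
e ⨾ᴾ f = tabulate (composite e f)

pointOp : (s : Sym) → Op s PointRel
pointOp 𝟘         = ∅ᴾ
pointOp 𝟙         = tabulate λ _ → true
pointOp minus e   = tabulate (not ∘ (e ∋ᴾ_))
pointOp plus e f  = tabulate λ k → e ∋ᴾ k ∨ f ∋ᴾ k
pointOp meet e f  = tabulate λ k → e ∋ᴾ k ∧ f ∋ᴾ k
pointOp ident     = atomic eq
pointOp conv e    = tabulate ((e ∋ᴾ_) ∘ converse)
pointOp comp      = _⨾ᴾ_

PointAlgebra : (τ : Signature) → Structure τ
PointAlgebra τ = record { Carrier = PointRel ; op = λ s _ → pointOp s }

∅ᴾ-zero : Zero _≡_ ∅ᴾ _⨾ᴾ_
∅ᴾ-zero = (λ _ → refl) , zeroʳ
  where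
  zeroʳ : ∀ e → e ⨾ᴾ ∅ᴾ ≡ ∅ᴾ
  zeroʳ (a , b , c) rewrite ∧-zeroʳ a | ∧-zeroʳ b | ∧-zeroʳ c = refl

PointRel↔Fin8 : PointRel ↔ Fin 8
PointRel↔Fin8 =
  ↔-sym (↔-trans (*↔× {2} {4}) (2↔Bool ×-↔ ↔-trans (*↔× {2} {2}) (2↔Bool ×-↔ 2↔Bool)))

module DenseRepresentation
  {X : Set} {_<_ : BRel X} (isSTO : IsStrictTotalOrder _≡_ _<_) (dense : Dense _<_)
  (unbounded-above : ∀ x → ∃ (x <_)) (unbounded-below : ∀ x → ∃ (_< x)) (x₀ : X)
  where
  open IsStrictTotalOrder isSTO using (compare; trans)

  _⟨_⟩_ : X → Atom → X → Set
  x ⟨ lt ⟩ y = x < y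
  x ⟨ eq ⟩ y = x ≡ y
  x ⟨ gt ⟩ y = y < x

  atom : X → X → Atom
  atom x y with compare x y
  ... | tri< _ _ _ = lt
  ... | tri≈ _ _ _ = eq
  ... | tri> _ _ _ = gt

  atom-holds : ∀ x y → x ⟨ atom x y ⟩ y
  atom-holds x y with compare x y
  ... | tri< x<y _ _ = x<y
  ... | tri≈ _ x≡y _ = x≡y
  ... | tri> _ _ y<x = y<x

  atom-unique : ∀ {x y} k → x ⟨ k ⟩ y → atom x y ≡ k
  atom-unique {x} {y} k xky with compare x y
  atom-unique lt _   | tri< _ _ _     = refl
  atom-unique eq x≡y | tri< _ x≢y _   = ⊥-elim (x≢y x≡y)
  atom-unique gt y<x | tri< _ _ y≮x   = ⊥-elim (y≮x y<x)
  atom-unique lt x<y | tri≈ x≮y _ _   = ⊥-elim (x≮y x<y)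
  atom-unique eq _   | tri≈ _ _ _     = refl
  atom-unique gt y<x | tri≈ _ _ y≮x   = ⊥-elim (y≮x y<x)
  atom-unique lt x<y | tri> x≮y _ _   = ⊥-elim (x≮y x<y)
  atom-unique eq x≡y | tri> _ x≢y _   = ⊥-elim (x≢y x≡y)
  atom-unique gt _   | tri> _ _ _     = refl

  atom-sound : ∀ {x y k} → k ≡ atom x y → x ⟨ k ⟩ y
  atom-sound {x} {y} k≡atom = subst (x ⟨_⟩ y) (sym k≡atom) (atom-holds x y)

  atom-converse : ∀ x y → atom y x ≡ converse (atom x y)
  atom-converse x y = atom-unique (converse (atom x y)) (flip (atom x y) (atom-holds x y))
    where
    flip : ∀ k → x ⟨ k ⟩ y → y ⟨ converse k ⟩ x
    flip lt x<y = x<y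
    flip eq refl = refl
    flip gt y<x = y<x

  upper-bound : ∀ x y → ∃ λ z → x < z × y < z
  upper-bound x y with compare x y
  ... | tri< x<y _ _ = let z , y<z = unbounded-above y in z , trans x<y y<z , y<z
  ... | tri≈ _ refl _ = let z , x<z = unbounded-above x in z , x<z , x<z
  ... | tri> _ _ y<x = let z , x<z = unbounded-above x in z , x<z , trans y<x x<z

  lower-bound : ∀ x y → ∃ λ z → z < x × z < y
  lower-bound x y with compare x y
  ... | tri< x<y _ _ = let z , z<x = unbounded-below x in z , z<x , trans z<x x<y
  ... | tri≈ _ refl _ = let z , z<x = unbounded-below x in z , z<x , z<x
  ... | tri> _ _ y<x = let z , z<y = unbounded-below y in z , trans z<y y<x , z<y

  ∈ᴬ⨾-sound : ∀ p q {x y z} → x ⟨ p ⟩ z → z ⟨ q ⟩ y → T (atom x y ∈ᴬ p ⨾ q)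
  ∈ᴬ⨾-sound eq q  refl zqy = from T-≟ᴬ (sym (atom-unique q zqy))
  ∈ᴬ⨾-sound lt eq xpz refl = from T-≟ᴬ (sym (atom-unique lt xpz))
  ∈ᴬ⨾-sound gt eq xpz refl = from T-≟ᴬ (sym (atom-unique gt xpz))
  ∈ᴬ⨾-sound lt lt x<z z<y  = from T-≟ᴬ (sym (atom-unique lt (trans x<z z<y)))
  ∈ᴬ⨾-sound gt gt z<x y<z  = from T-≟ᴬ (sym (atom-unique gt (trans y<z z<x)))
  ∈ᴬ⨾-sound lt gt _ _      = _
  ∈ᴬ⨾-sound gt lt _ _      = _

  ∈ᴬ⨾-complete : ∀ p q {x y} → T (atom x y ∈ᴬ p ⨾ q) → ∃ λ z → x ⟨ p ⟩ z × z ⟨ q ⟩ y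
  ∈ᴬ⨾-complete eq q  {x}     t = x , refl , atom-sound (to T-≟ᴬ t)
  ∈ᴬ⨾-complete lt eq {y = y} t = y , atom-sound (to T-≟ᴬ t) , refl
  ∈ᴬ⨾-complete gt eq {y = y} t = y , atom-sound (to T-≟ᴬ t) , refl
  ∈ᴬ⨾-complete lt lt         t = dense (atom-sound (to T-≟ᴬ t))
  ∈ᴬ⨾-complete gt gt         t =
    let z , y<z , z<x = dense (atom-sound (to T-≟ᴬ t)) in z , z<x , y<z
  ∈ᴬ⨾-complete lt gt {x} {y} _ = upper-bound x y
  ∈ᴬ⨾-complete gt lt {x} {y} _ = lower-bound x y

  ⟦_⟧ : PointRel → BRel X
  ⟦ e ⟧ x y = T (e ∋ᴾ atom x y)

  ⟦⟧-intro : ∀ e k {x y} → x ⟨ k ⟩ y → T (e ∋ᴾ k) → ⟦ e ⟧ x y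
  ⟦⟧-intro e k xky = subst (T ∘ (e ∋ᴾ_)) (sym (atom-unique k xky))

  ⟦⟧-elim : ∀ e k {x y} → x ⟨ k ⟩ y → ⟦ e ⟧ x y → T (e ∋ᴾ k)
  ⟦⟧-elim e k xky = subst (T ∘ (e ∋ᴾ_)) (atom-unique k xky)

  ⟦tabulate⟧ : ∀ g {R : BRel X} → (∀ x y → T (g (atom x y)) ⇔ R x y) → ⟦ tabulate g ⟧ ≐ R
  ⟦tabulate⟧ g g⇔R =
      (λ x y → to (g⇔R x y) ∘ subst T (tabulate-∋ᴾ g (atom x y)))
    , (λ x y → subst T (sym (tabulate-∋ᴾ g (atom x y))) ∘ from (g⇔R x y))

  ⟦⟧-⨾ : ∀ e f → ⟦ e ⨾ᴾ f ⟧ ≐ (⟦ e ⟧ ⨾ᴿ ⟦ f ⟧)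
  ⟦⟧-⨾ e f = ⟦tabulate⟧ (composite e f) λ x y →
    mk⇔ (split x y ∘ to (T-composite {e} {f})) (from (T-composite {e} {f}) ∘ join x y)
    where
    Factors : X → X → Set
    Factors x y = ∃₂ λ p q → T (e ∋ᴾ p) × T (f ∋ᴾ q) × T (atom x y ∈ᴬ p ⨾ q)

    split : ∀ x y → Factors x y → (⟦ e ⟧ ⨾ᴿ ⟦ f ⟧) x y
    split x y (p , q , ep , fq , t) =
      let z , xpz , zqy = ∈ᴬ⨾-complete p q t
      in z , ⟦⟧-intro e p xpz ep , ⟦⟧-intro f q zqy fq

    join : ∀ x y → (⟦ e ⟧ ⨾ᴿ ⟦ f ⟧) x y → Factors x y
    join x y (z , exz , fzy) =
      atom x z , atom z y , exz , fzy ,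
      ∈ᴬ⨾-sound (atom x z) (atom z y) (atom-holds x z) (atom-holds z y)

  ⟦⟧-hom : ∀ s → Hom s ⟦_⟧ (pointOp s)
  ⟦⟧-hom 𝟘          = ⟦tabulate⟧ (λ _ → false) λ _ _ → mk⇔ (λ ()) (λ ())
  ⟦⟧-hom 𝟙          = ⟦tabulate⟧ (λ _ → true) λ _ _ → mk⇔ _ _
  ⟦⟧-hom minus e    = ⟦tabulate⟧ (not ∘ (e ∋ᴾ_)) λ _ _ → T-not
  ⟦⟧-hom plus e f   = ⟦tabulate⟧ (λ k → e ∋ᴾ k ∨ f ∋ᴾ k) λ _ _ → T-∨
  ⟦⟧-hom meet e f   = ⟦tabulate⟧ (λ k → e ∋ᴾ k ∧ f ∋ᴾ k) λ _ _ → T-∧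
  ⟦⟧-hom ident      = ⟦tabulate⟧ (λ k → ⌊ k ≟ᴬ eq ⌋) λ x y →
    mk⇔ (atom-sound ∘ sym ∘ to T-≟ᴬ) (from T-≟ᴬ ∘ atom-unique eq)
  ⟦⟧-hom conv e     = ⟦tabulate⟧ ((e ∋ᴾ_) ∘ converse) λ x y →
    let same = atom-converse x y
    in mk⇔ (subst (T ∘ (e ∋ᴾ_)) (sym same)) (subst (T ∘ (e ∋ᴾ_)) same)
  ⟦⟧-hom comp       = ⟦⟧-⨾

  atom-witness : ∀ k → ∃₂ λ x y → x ⟨ k ⟩ y
  atom-witness lt = let x₁ , x₀<x₁ = unbounded-above x₀ in x₀ , x₁ , x₀<x₁
  atom-witness eq = x₀ , x₀ , refl
  atom-witness gt = let x₁ , x₀<x₁ = unbounded-above x₀ in x₁ , x₀ , x₀<x₁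

  ⟦⟧-injective : ∀ e f → ⟦ e ⟧ ≐ ⟦ f ⟧ → e ≡ f
  ⟦⟧-injective e f (e⊆f , f⊆e) = ∋ᴾ-injective λ k →
    let x , y , xky = atom-witness k
    in T-injective (⟦⟧-elim f k xky ∘ e⊆f x y ∘ ⟦⟧-intro e k xky)
                   (⟦⟧-elim e k xky ∘ f⊆e x y ∘ ⟦⟧-intro f k xky)

  representation : (τ : Signature) → Representation (PointAlgebra τ) X
  representation τ = record { h = ⟦_⟧ ; inj = ⟦⟧-injective ; hom = λ s _ → ⟦⟧-hom s }

ℚ-unbounded-above : ∀ x → ∃ (x ℚ.<_)
ℚ-unbounded-above x = x + 1ℚ , subst (ℚ._< x + 1ℚ) (+-identityʳ x) (+-monoʳ-< x (positive⁻¹ 1ℚ))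

ℚ-unbounded-below : ∀ x → ∃ (ℚ._< x)
ℚ-unbounded-below x = x + - 1ℚ , subst (x + - 1ℚ ℚ.<_) (+-identityʳ x) (+-monoʳ-< x (negative⁻¹ (- 1ℚ)))

open DenseRepresentation <-isStrictTotalOrder <-dense ℚ-unbounded-above ℚ-unbounded-below 1ℚ
  using () renaming (representation to ℚ-representation)

theorem1 : (τ : Signature) → T (τ minus) → T (τ comp) → ¬ FRP τ
theorem1 τ minus∈τ comp∈τ frp =
  no-finite-representation (PointAlgebra τ) minus∈τ comp∈τ {r = atomic lt} ∅ᴾ-zero (λ ()) refl refl
    (frp (PointAlgebra τ) (8 , PointRel↔Fin8) (ℚ , ℚ-representation τ))
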